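{- The following problem is decidable: given a finite convergent, forward-closed string rewriting system $R$ over a finite alphabet $\Sigma$, a string $u \in \Sigma^+$ and a string $v \in \Sigma^+$, does there exist a string $w \in \Sigma^+$ such that $uw \to_R^! v$?
   Context: A string rewriting system $R$ over $\Sigma$ is a set of rules $l\to r$ ($l,r\in\Sigma^*$) with rewrite relation $xly\to_R xry$; $w\to_R^! w'$ means $w\to_R^* w'$ and $w'$ is irreducible (no rule applies to it). $R$ is convergent if terminating and confluent. A redex is a string $wl$ with $l$ a left-hand side; it is innermost if no proper prefix is a redex; $R$ is forward-closed if every innermost redex reduces to its normal form in one step. (This is the "cap problem": $u$ is the intruder knowledge, $v$ the secret, $w$ a cap term.) -}

module Defs where

open import Data.Nat using (ℕ)
open import Data.Fin using (Fin)
open import Data.List using (List; []; _++_)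
open import Data.List.Membership.Propositional using (_∈_)
open import Data.Product using (Σ; ∃; ∃-syntax; _×_; _,_)
open import Relation.Binary.PropositionalEquality using (_≡_)
open import Relation.Binary.Construct.Closure.ReflexiveTransitive using (Star)
open import Relation.Nullary using (¬_)
open import Induction.WellFounded using (WellFounded)

Str : ℕ → Set
Str k = List (Fin k)

Rule : ℕ → Set
Rule k = Str k × Str k

SRS : ℕ → Set
SRS k = List (Rule k)

module _ {k : ℕ} (R : SRS k) where

  Step : Str k → Str k → Set
  Step s t = ∃[ x ] ∃[ y ] ∃[ l ] ∃[ r ]
               ((l , r) ∈ R × s ≡ x ++ l ++ y × t ≡ x ++ r ++ y)

  Steps : Str k → Str k → Set
  Steps = Star Step

  Irreducible : Str k → Set
  Irreducible s = ∀ t → ¬ Step s t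

  NormalForm : Str k → Str k → Set
  NormalForm w w' = Steps w w' × Irreducible w'

  Terminating : Set
  Terminating = WellFounded (λ t s → Step s t)

  Confluent : Set
  Confluent = ∀ {a b c} → Steps a b → Steps a c → ∃[ d ] (Steps b d × Steps c d)

  Convergent : Set
  Convergent = Terminating × Confluent

  Redex : Str k → Set
  Redex s = ∃[ w ] ∃[ l ] ∃[ r ] ((l , r) ∈ R × s ≡ w ++ l)

  InnermostRedex : Str k → Set
  InnermostRedex s = Redex s × (∀ p q → s ≡ p ++ q → ¬ q ≡ [] → ¬ Redex p)

  ForwardClosed : Set
  ForwardClosed = ∀ s → InnermostRedex s → ∃[ t ] (Step s t × Irreducible t)

-- The normal form of u w is computed letter by letter by δ s a = nf (s a). For irreducible s,
-- forward closure normalises s a with at most one rewrite, at the end. So δ lengthens s by at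
-- most ρ and, when s = p y with |y| at least the maximal left-hand-side length W, it works
-- inside y only: δ (p y) a = p (δ y a). Strings reachable from nf u thus behave like the
-- configurations of a pushdown system, and runs between strings of length at most M (with M at
-- least W + ρ, |nf u| and |v|) are captured by the least set of facts closed under single
-- moves, composition through strings of length at most M, and putting a common prefix under a
-- run whose moves all start at length at least W. Every such run is derived: split its start
-- as p y with |y| = W and cut the run where the part above p first gets shorter than W. The
-- universe of facts is finite, so the least set is computable.

module Submission where

open import Defs
open import Data.Bool using (Bool; true; false; T)
open import Data.Empty using (⊥; ⊥-elim)
open import Induction.WellFounded using (Acc; acc)
open import Data.Fin using (Fin)
import Data.Fin.Properties as Fin
open import Data.List
  using (List; []; _∷_; _++_; [_]; length; map; filter; foldl; take; drop; allFin; cartesianProduct)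
open import Data.List.Properties
  using (∷-injectiveˡ; ∷-injectiveʳ; length-++; length-++-≤ʳ; length-drop; take++drop≡id; ≡-dec; ++-assoc; ++-identityʳ)
open import Data.List.Membership.Propositional using (_∈_; find; lose)
open import Data.List.Membership.Propositional.Properties
  using (∈-map⁺; ∈-map⁻; ∈-allFin; ∈-cartesianProduct⁺; ∈-filter⁺; ∈-filter⁻)
open import Data.List.Relation.Unary.Any as Any using (Any; here; there)
open import Data.List.Relation.Unary.All as All using ()
open import Data.List.Extrema.Nat using (max; xs≤max)
open import Data.List.Relation.Binary.Infix.Heterogeneous using (Infix; MkView; toView; fromView)
open import Data.List.Relation.Binary.Infix.Heterogeneous.Properties using (infix?)
open import Data.List.Relation.Binary.Pointwise using (Pointwise-≡⇒≡; ≡⇒Pointwise-≡)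
open import Data.List.Relation.Binary.Sublist.Heterogeneous using (Sublist)
open import Data.List.Relation.Binary.Sublist.Heterogeneous.Properties
  using (⊆-filter-Sublist; filter-Sublist; fromPointwise; toPointwise; length-mono-≤)
open import Data.Nat using (ℕ; zero; suc; _+_; _∸_; _≤_; _<_; z≤n; s≤s; _≟_; _≤?_)
open import Data.Nat.Properties
open import Data.Product using (Σ; ∃-syntax; _×_; _,_; proj₁; proj₂)
open import Data.Sum using (_⊎_; inj₁; inj₂)
open import Relation.Binary.PropositionalEquality hiding ([_])
open import Relation.Binary.Construct.Closure.ReflexiveTransitive using (ε; _◅_; _◅◅_)
open import Relation.Binary.Construct.Closure.Transitive
  using (TransClosure; _∷_) renaming ([_] to [_]⁺; _++_ to _++⁺_)
open import Relation.Nullary using (¬_; Dec; yes; no)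
open import Relation.Nullary.Decidable using (⌊_⌋; T?; toWitness; fromWitness; _×-dec_; _⊎-dec_)

module _ {a} {A : Set a} where

  length-∷ʳ : ∀ (xs : List A) x → length (xs ++ [ x ]) ≡ suc (length xs)
  length-∷ʳ xs x = trans (length-++ xs) (+-comm (length xs) 1)

  ∷ʳ-prefix : ∀ (xs ys : List A) {x z zs} → xs ++ [ x ] ≡ ys ++ z ∷ zs → ∃[ ws ] xs ≡ ys ++ ws
  ∷ʳ-prefix xs       []          _  = xs , refl
  ∷ʳ-prefix []       (_ ∷ [])    ()
  ∷ʳ-prefix []       (_ ∷ _ ∷ _) ()
  ∷ʳ-prefix (_ ∷ xs) (_ ∷ ys)    eq with ∷ʳ-prefix xs ys (∷-injectiveʳ eq)
  ... | ws , xs≡ys++ws = ws , cong₂ _∷_ (∷-injectiveˡ eq) xs≡ys++ws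

  short-suffix : ∀ (xs ys zs ws : List A) → xs ++ ys ≡ zs ++ ws → length ws ≤ length ys →
                 ∃[ vs ] zs ≡ xs ++ vs × ys ≡ vs ++ ws
  short-suffix []       ys zs       ws eq _  = zs , refl , eq
  short-suffix (x ∷ xs) ys []       ws eq le = ⊥-elim (<-irrefl refl (begin-strict
    length ys              ≤⟨ m≤n+m (length ys) (length xs) ⟩
    length xs + length ys  ≡⟨ length-++ xs ⟨
    length (xs ++ ys)      <⟨ ≤-refl ⟩
    length (x ∷ xs ++ ys)  ≡⟨ cong length eq ⟩
    length ws              ≤⟨ le ⟩
    length ys              ∎))
    where open ≤-Reasoning
  short-suffix (x ∷ xs) ys (z ∷ zs) ws eq le with short-suffix xs ys zs ws (∷-injectiveʳ eq) le
  ... | vs , zs≡xs++vs , ys≡vs++ws = vs , cong₂ _∷_ (sym (∷-injectiveˡ eq)) zs≡xs++vs , ys≡vs++ws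

  split-suffix : ∀ (s : List A) {n} → n ≤ length s → ∃[ p ] ∃[ u ] s ≡ p ++ u × length u ≡ n
  split-suffix s {n} n≤s =
    take (length s ∸ n) s , drop (length s ∸ n) s , sym (take++drop≡id (length s ∸ n) s) ,
    trans (length-drop (length s ∸ n) s) (m∸[m∸n]≡n n≤s)

  splits : List A → List (List A × List A)
  splits []       = [ ([] , []) ]
  splits (x ∷ xs) = ([] , x ∷ xs) ∷ map (λ (ys , zs) → x ∷ ys , zs) (splits xs)

  ∈-splits : ∀ xs ys → (xs , ys) ∈ splits (xs ++ ys)
  ∈-splits []       []       = here refl
  ∈-splits []       (_ ∷ _)  = here refl
  ∈-splits (x ∷ xs) ys       = there (∈-map⁺ _ (∈-splits xs ys))

  splits-sound : ∀ {xs ys} zs → (xs , ys) ∈ splits zs → zs ≡ xs ++ ys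
  splits-sound []       (here refl) = refl
  splits-sound (_ ∷ _)  (here refl) = refl
  splits-sound (z ∷ zs) (there m) with ∈-map⁻ _ m
  ... | _ , m′ , refl = cong (z ∷_) (splits-sound zs m′)

  words≤ : List A → ℕ → List (List A)
  words≤ letters zero    = [ [] ]
  words≤ letters (suc n) = [] ∷ map (λ (x , w) → x ∷ w) (cartesianProduct letters (words≤ letters n))

  ∈-words≤ : ∀ {letters} n w → (∀ {x} → x ∈ letters) → length w ≤ n → w ∈ words≤ letters n
  ∈-words≤ zero    []      _   _         = here refl
  ∈-words≤ (suc n) []      _   _         = here refl
  ∈-words≤ (suc n) (x ∷ w) all (s≤s le) =
    there (∈-map⁺ _ (∈-cartesianProduct⁺ all (∈-words≤ n w all le)))

monotone-bounded-stalls : ∀ (f : ℕ → ℕ) {B} → (∀ n → f n ≤ f (suc n)) → (∀ n → f n ≤ B) →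
                          ∃[ n ] f n ≡ f (suc n)
monotone-bounded-stalls f {B} mono bounded with climb (suc B)
  where
  climb : ∀ n → (∃[ i ] f i ≡ f (suc i)) ⊎ n ≤ f n
  climb zero    = inj₂ z≤n
  climb (suc n) with climb n
  ... | inj₁ stall = inj₁ stall
  ... | inj₂ n≤fn with f n ≟ f (suc n)
  ...   | yes stall = inj₁ (n , stall)
  ...   | no  moved = inj₂ (<-≤-trans (s≤s n≤fn) (≤∧≢⇒< (mono n) moved))
... | inj₁ stall = stall
... | inj₂ B<fB  = ⊥-elim (<⇒≱ B<fB (bounded (suc B)))

module _ {a r} {A : Set a} {_∼_ : A → A → Set r} where

  size⁺ : ∀ {x y} → TransClosure _∼_ x y → ℕ
  size⁺ [ _ ]⁺     = 1
  size⁺ (_ ∷ rest) = suc (size⁺ rest)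

  size⁺-positive : ∀ {x y} (steps : TransClosure _∼_ x y) → 1 ≤ size⁺ steps
  size⁺-positive [ _ ]⁺  = s≤s z≤n
  size⁺-positive (_ ∷ _) = s≤s z≤n

  map⁺ : ∀ {s} {_≈_ : A → A → Set s} → (∀ {x y} → x ∼ y → x ≈ y) →
         ∀ {x y} → TransClosure _∼_ x y → TransClosure _≈_ x y
  map⁺ f [ x∼y ]⁺     = [ f x∼y ]⁺
  map⁺ f (x∼y ∷ rest) = f x∼y ∷ map⁺ f rest

both-below : ∀ {m n o} → 1 ≤ m → 1 ≤ n → m + n ≤ suc o → m ≤ o × n ≤ o
both-below {m} {n} {o} 1≤m 1≤n m+n≤1+o =
  ≤-pred (≤-trans (≤-reflexive (+-comm 1 m)) (≤-trans (+-monoʳ-≤ m 1≤n) m+n≤1+o)) ,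
  ≤-pred (≤-trans (+-monoˡ-≤ n 1≤m) m+n≤1+o)

_⊆ᵇ_ : ∀ {a} {A : Set a} → (A → Bool) → (A → Bool) → Set a
S ⊆ᵇ S′ = ∀ {x} → T (S x) → T (S′ x)

-- The number of derived elements
-- of the finite universe only grows, so it stalls; the stage where it does is closed under
-- derivation on the universe (outside the universe nothing is claimed).
module Saturation {a ℓ} {A : Set a} (universe : List A)
  (Derivable : (A → Bool) → A → Set ℓ)
  (derivable? : ∀ S x → Dec (Derivable S x))
  (derivable-mono : ∀ {S S′} → S ⊆ᵇ S′ → ∀ {x} → Derivable S x → Derivable S′ x) where

  next : (A → Bool) → A → Bool
  next S x = ⌊ derivable? S x ⌋

  stage : ℕ → A → Bool
  stage zero    _ = false
  stage (suc n) = next (stage n)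

  next-mono : ∀ {S S′} → S ⊆ᵇ S′ → next S ⊆ᵇ next S′
  next-mono {S} {S′} S⊆S′ {x} x∈next =
    fromWitness {a? = derivable? S′ x} (derivable-mono S⊆S′ (toWitness {a? = derivable? S x} x∈next))

  stage-⊆ : ∀ n → stage n ⊆ᵇ stage (suc n)
  stage-⊆ zero    ()
  stage-⊆ (suc n) = next-mono (stage-⊆ n)

  known : (A → Bool) → List A
  known S = filter (λ x → T? (S x)) universe

  universe-⊆ : Sublist _≡_ universe universe
  universe-⊆ = fromPointwise (≡⇒Pointwise-≡ refl)

  known-⊆ : ∀ {S S′} → S ⊆ᵇ S′ → Sublist _≡_ (known S) (known S′)
  known-⊆ {S} {S′} S⊆S′ =
    ⊆-filter-Sublist (λ x → T? (S x)) (λ x → T? (S′ x)) (λ { refl → S⊆S′ }) universe-⊆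

  known-bounded : ∀ S → length (known S) ≤ length universe
  known-bounded S = length-mono-≤ (filter-Sublist (λ x → T? (S x)) universe-⊆)

  stall : ∃[ n ] length (known (stage n)) ≡ length (known (stage (suc n)))
  stall = monotone-bounded-stalls (λ n → length (known (stage n)))
            (λ n → length-mono-≤ (known-⊆ (stage-⊆ n))) (λ n → known-bounded (stage n))

  lfp : A → Bool
  lfp = stage (proj₁ stall)

  lfp-closed : ∀ {x} → x ∈ universe → Derivable lfp x → T (lfp x)
  lfp-closed {x} x∈U derivable = proj₂ (∈-filter⁻ (λ x → T? (lfp x)) {xs = universe} x∈known)
    where
    same : known lfp ≡ known (next lfp)
    same = Pointwise-≡⇒≡ (toPointwise (proj₂ stall) (known-⊆ (stage-⊆ (proj₁ stall))))
    x∈known : x ∈ known lfp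
    x∈known = subst (x ∈_) (sym same)
                (∈-filter⁺ (λ x → T? (next lfp x)) x∈U (fromWitness {a? = derivable? lfp x} derivable))

  lfp-sound : ∀ {p} (P : A → Set p) →
              (∀ {S} → (∀ {x} → T (S x) → P x) → ∀ {x} → Derivable S x → P x) →
              ∀ {x} → T (lfp x) → P x
  lfp-sound P preserved = stage-sound (proj₁ stall)
    where
    stage-sound : ∀ n {x} → T (stage n x) → P x
    stage-sound zero    ()
    stage-sound (suc n) {x} x∈stage =
      preserved (stage-sound n) (toWitness {a? = derivable? (stage n) x} x∈stage)

module Rewriting {k : ℕ} (R : SRS k) where

  step-++ʳ : ∀ {x x′} y → Step R x x′ → Step R (x ++ y) (x′ ++ y)
  step-++ʳ y (u , v , l , r , l→r , refl , refl) =
    u , v ++ y , l , r , l→r ,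
    trans (++-assoc u (l ++ v) y) (cong (u ++_) (++-assoc l v y)) ,
    trans (++-assoc u (r ++ v) y) (cong (u ++_) (++-assoc r v y))

  steps-++ʳ : ∀ {x x′} y → Steps R x x′ → Steps R (x ++ y) (x′ ++ y)
  steps-++ʳ y ε          = ε
  steps-++ʳ y (st ◅ sts) = step-++ʳ y st ◅ steps-++ʳ y sts

  irreducible-++⁻ʳ : ∀ x {y} → Irreducible R (x ++ y) → Irreducible R y
  irreducible-++⁻ʳ x irr _ (u , v , l , r , l→r , refl , refl) =
    irr _ (x ++ u , v , l , r , l→r , sym (++-assoc x u (l ++ v)) , refl)

  irreducible-steps : ∀ {s t} → Irreducible R s → Steps R s t → s ≡ t
  irreducible-steps irr ε        = refl
  irreducible-steps irr (st ◅ _) = ⊥-elim (irr _ st)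

  reducible? : ∀ s → Dec (∃[ t ] Step R s t)
  reducible? s with Any.any? (λ (l , _) → infix? Fin._≟_ l s) R
  ... | yes occurs = yes (redex-step (find occurs))
    where
    redex-step : (∃[ (l , r) ] (l , r) ∈ R × Infix _≡_ l s) → ∃[ t ] Step R s t
    redex-step ((l , r) , l→r , l⊆s) with toView l⊆s
    ... | MkView u l≡l′ v =
      u ++ r ++ v , u , v , l , r , l→r , cong (λ l′ → u ++ l′ ++ v) (sym (Pointwise-≡⇒≡ l≡l′)) , refl
  ... | no none = no λ { (_ , u , v , l , r , l→r , refl , _) →
                         none (lose l→r (fromView (MkView u (≡⇒Pointwise-≡ refl) v))) }

  lhs-nonempty : Terminating R → ∀ {l r} → (l , r) ∈ R → 1 ≤ length l
  lhs-nonempty terminating {[]} {r} l→r = ⊥-elim (diverges [] (terminating []))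
    where
    diverges : ∀ s → Acc (λ t s → Step R s t) s → ⊥
    diverges s (acc rec) = diverges (r ++ s) (rec ([] , s , [] , r , l→r , refl , refl))
  lhs-nonempty terminating {_ ∷ _} _ = s≤s z≤n

module NormalForms {k : ℕ} (R : SRS k) (terminating : Terminating R) (confluent : Confluent R) where
  open Rewriting R

  normalise : ∀ s → Acc (λ t s → Step R s t) s → ∃[ t ] NormalForm R s t
  normalise s (acc rec) with reducible? s
  ... | no irr       = s , ε , λ t st → irr (t , st)
  ... | yes (t , st) with normalise t (rec st)
  ...   | n , sts , irr = n , st ◅ sts , irr

  nf : Str k → Str k
  nf s = proj₁ (normalise s (terminating s))

  nf-normalForm : ∀ s → NormalForm R s (nf s)
  nf-normalForm s = proj₂ (normalise s (terminating s))

  nf-irreducible : ∀ s → Irreducible R (nf s)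
  nf-irreducible s = proj₂ (nf-normalForm s)

  nf-unique : ∀ {s t} → NormalForm R s t → nf s ≡ t
  nf-unique {s} (s→t , irr) with confluent (proj₁ (nf-normalForm s)) s→t
  ... | _ , nf→d , t→d = trans (irreducible-steps (nf-irreducible s) nf→d) (sym (irreducible-steps irr t→d))

  nf-++ : ∀ x y → nf (x ++ y) ≡ nf (nf x ++ y)
  nf-++ x y = nf-unique (steps-++ʳ y (proj₁ (nf-normalForm x)) ◅◅ proj₁ (nf-normalForm (nf x ++ y)) ,
                         nf-irreducible (nf x ++ y))

module Transitions {k : ℕ} (R : SRS k) (terminating : Terminating R) (confluent : Confluent R)
                   (forwardClosed : ForwardClosed R) where
  open Rewriting R
  open NormalForms R terminating confluent

  δ : Str k → Fin k → Str k
  δ s a = nf (s ++ [ a ])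

  δ-irreducible : ∀ s a → Irreducible R (δ s a)
  δ-irreducible s a = nf-irreducible (s ++ [ a ])

  W : ℕ
  W = max 0 (map (λ (l , _) → length l) R)

  ρ : ℕ
  ρ = suc (max 0 (map (λ (_ , r) → length r) R))

  lhs≤W : ∀ {l r} → (l , r) ∈ R → length l ≤ W
  lhs≤W l→r = All.lookup (xs≤max 0 _) (∈-map⁺ (λ (l , _) → length l) l→r)

  rhs<ρ : ∀ {l r} → (l , r) ∈ R → length r < ρ
  rhs<ρ l→r = s≤s (All.lookup (xs≤max 0 _) (∈-map⁺ (λ (_ , r) → length r) l→r))

  step-at-end : ∀ {P a t} → Irreducible R P → Step R (P ++ [ a ]) t →
                ∃[ x ] ∃[ l ] ∃[ r ] ((l , r) ∈ R × P ++ [ a ] ≡ x ++ l × t ≡ x ++ r)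
  step-at-end irr (x , [] , l , r , l→r , eq , refl) =
    x , l , r , l→r , trans eq (cong (x ++_) (++-identityʳ l)) , cong (x ++_) (++-identityʳ r)
  step-at-end {P} irr (x , b ∷ y , l , r , l→r , eq , _)
    with ∷ʳ-prefix P (x ++ l) (trans eq (sym (++-assoc x l (b ∷ y))))
  ... | w , P≡xlw = ⊥-elim (irr _ (x , w , l , r , l→r , trans P≡xlw (++-assoc x l w) , refl))

  innermost : ∀ {P a} → Irreducible R P → Redex R (P ++ [ a ]) → InnermostRedex R (P ++ [ a ])
  innermost {P} irr redex = redex , proper-prefix-irreducible
    where
    proper-prefix-irreducible : ∀ p q → P ++ [ _ ] ≡ p ++ q → ¬ q ≡ [] → ¬ Redex R p
    proper-prefix-irreducible _ []      _  nonempty _ = nonempty refl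
    proper-prefix-irreducible _ (_ ∷ _) eq _ (w , l , r , l→r , refl) with ∷ʳ-prefix P (w ++ l) eq
    ... | v , P≡wlv = irr _ (w , v , l , r , l→r , trans P≡wlv (++-assoc w l v) , refl)

  data Edit : Str k → Str k → Set where
    rule : ∀ {l r} → (l , r) ∈ R → Edit l r
    keep : ∀ a → Edit [ a ] [ a ]

  edit-steps : ∀ {l r} → Edit l r → ∀ x → Steps R (x ++ l) (x ++ r)
  edit-steps (rule {l} {r} l→r) x =
    (x , [] , l , r , l→r , cong (x ++_) (sym (++-identityʳ l)) , cong (x ++_) (sym (++-identityʳ r))) ◅ ε
  edit-steps (keep a) x = ε

  edit-lhs : ∀ {l r} → Edit l r → 1 ≤ length l × length l ≤ suc W
  edit-lhs (rule l→r) = lhs-nonempty terminating l→r , m≤n⇒m≤1+n (lhs≤W l→r)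
  edit-lhs (keep a)   = ≤-refl , s≤s z≤n

  edit-rhs : ∀ {l r} → Edit l r → length r ≤ ρ
  edit-rhs (rule l→r) = <⇒≤ (rhs<ρ l→r)
  edit-rhs (keep a)   = s≤s z≤n

  δ-edit : ∀ {P} a → Irreducible R P →
           ∃[ x ] ∃[ l ] ∃[ r ] (Edit l r × P ++ [ a ] ≡ x ++ l × δ P a ≡ x ++ r)
  δ-edit {P} a irr with reducible? (P ++ [ a ])
  ... | no irr′ = P , [ a ] , [ a ] , keep a , refl , nf-unique (ε , λ t st → irr′ (t , st))
  ... | yes (_ , st) with step-at-end irr st
  ...   | x , l , r , l→r , eq , _ with forwardClosed _ (innermost irr (x , l , r , l→r , eq))
  ...     | t , st′ , irr-t with step-at-end irr st′
  ...       | x′ , l′ , r′ , l′→r′ , eq′ , refl =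
    x′ , l′ , r′ , rule l′→r′ , eq′ , nf-unique (st′ ◅ ε , irr-t)

  δ-local : ∀ p {y} a → Irreducible R (p ++ y) → W ≤ length y → δ (p ++ y) a ≡ p ++ δ y a
  δ-local p {y} a irr W≤y with δ-edit a irr
  ... | x , l , r , edit , eq , δ≡
    with short-suffix p (y ++ [ a ]) x l (trans (sym (++-assoc p y [ a ])) eq) l≤ya
    where
    l≤ya : length l ≤ length (y ++ [ a ])
    l≤ya = ≤-trans (proj₂ (edit-lhs edit)) (≤-trans (s≤s W≤y) (≤-reflexive (sym (length-∷ʳ y a))))
  ... | x′ , refl , ya≡x′l = begin
    δ (p ++ y) a     ≡⟨ trans δ≡ (++-assoc p x′ r) ⟩
    p ++ x′ ++ r     ≡⟨ cong (p ++_) δy≡x′r ⟨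
    p ++ δ y a       ∎
    where
    open ≡-Reasoning
    δy≡x′r : δ y a ≡ x′ ++ r
    δy≡x′r = nf-unique (subst (λ s → Steps R s (x′ ++ r)) (sym ya≡x′l) (edit-steps edit x′) ,
                        irreducible-++⁻ʳ p (subst (Irreducible R) (trans δ≡ (++-assoc p x′ r))
                                                  (δ-irreducible (p ++ y) a)))

  δ-length : ∀ s a → Irreducible R s → length (δ s a) ≤ length s + ρ
  δ-length s a irr with δ-edit a irr
  ... | x , l , r , edit , eq , δ≡ = begin
    length (δ s a)        ≡⟨ trans (cong length δ≡) (length-++ x) ⟩
    length x + length r   ≤⟨ +-mono-≤ x≤s (edit-rhs edit) ⟩
    length s + ρ          ∎
    where
    open ≤-Reasoning
    x≤s : length x ≤ length s
    x≤s = ≤-pred (begin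
      suc (length x)        ≡⟨ +-comm 1 (length x) ⟩
      length x + 1          ≤⟨ +-monoʳ-≤ (length x) (proj₁ (edit-lhs edit)) ⟩
      length x + length l   ≡⟨ trans (cong length eq) (length-++ x) ⟨
      length (s ++ [ a ])   ≡⟨ length-∷ʳ s a ⟩
      suc (length s)        ∎)

module Runs {k : ℕ} (R : SRS k) (terminating : Terminating R) (confluent : Confluent R)
            (forwardClosed : ForwardClosed R) where
  open Rewriting R
  open NormalForms R terminating confluent
  open Transitions R terminating confluent forwardClosed public

  High : Str k → Set
  High s = W ≤ length s

  data Kind : Set where
    high any : Kind

  Move : Kind → Str k → Str k → Set
  Move any  s t = ∃[ a ] δ s a ≡ t
  Move high s t = High s × Move any s t

  Run : Kind → Str k → Str k → Set
  Run κ = TransClosure (Move κ)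

  move-irreducible : ∀ κ {s t} → Move κ s t → Irreducible R t
  move-irreducible any  (a , refl) = δ-irreducible _ a
  move-irreducible high (_ , a , refl) = δ-irreducible _ a

  run-irreducible : ∀ κ {s t} → Run κ s t → Irreducible R t
  run-irreducible κ [ move ]⁺   = move-irreducible κ move
  run-irreducible κ (_ ∷ rest) = run-irreducible κ rest

  forget : ∀ {s t} → Run high s t → Run any s t
  forget = map⁺ proj₂

  run-high : ∀ {s t} → Run high s t → High s
  run-high [ (h , _) ]⁺  = h
  run-high ((h , _) ∷ _) = h

  lift-move : ∀ p {u u′} → Irreducible R (p ++ u) → Move high u u′ → Move high (p ++ u) (p ++ u′)
  lift-move p {u} irr (h , a , refl) = ≤-trans h (length-++-≤ʳ u {p}) , a , δ-local p a irr h

  lift : ∀ p {u u′} → Irreducible R (p ++ u) → Run high u u′ → Run high (p ++ u) (p ++ u′)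
  lift p irr [ move ]⁺     = [ lift-move p irr move ]⁺
  lift p irr (move ∷ rest) =
    lift-move p irr move ∷ lift p (move-irreducible high (lift-move p irr move)) rest

  -- Either the run never touches p, or the part above p first gets shorter than W at p ++ z.
  unlift : ∀ p {y s′} → Irreducible R (p ++ y) → High y → (run : Run high (p ++ y) s′) →
           (∃[ y′ ] s′ ≡ p ++ y′ × Σ (Run high y y′) λ run′ → size⁺ run′ ≡ size⁺ run)
           ⊎ (∃[ z ] length z < W × Σ (Run high y z) λ r₁ → Σ (Run high (p ++ z) s′) λ r₂ →
                size⁺ r₁ + size⁺ r₂ ≡ size⁺ run)
  unlift p {y} irr hy [ (_ , a , refl) ]⁺ = inj₁ (δ y a , δ-local p a irr hy , [ (hy , a , refl) ]⁺ , refl)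
  unlift p {y} irr hy ((_ , a , e) ∷ rest) with trans (sym e) (δ-local p a irr hy)
  ... | refl with W ≤? length (δ y a)
  ...   | no low  = inj₂ (δ y a , ≰⇒> low , [ (hy , a , refl) ]⁺ , rest , refl)
  ...   | yes hδ with unlift p (move-irreducible any (a , e)) hδ rest
  ...     | inj₁ (y′ , s′≡ , run′ , size≡)    = inj₁ (y′ , s′≡ , (hy , a , refl) ∷ run′ , cong suc size≡)
  ...     | inj₂ (z , z<W , r₁ , r₂ , size≡) = inj₂ (z , z<W , (hy , a , refl) ∷ r₁ , r₂ , cong suc size≡)

  high-prefix : ∀ {s s′} → High s → (run : Run any s s′) →
                (Σ (Run high s s′) λ h → size⁺ h ≡ size⁺ run)
                ⊎ (∃[ m ] length m < W × Σ (Run high s m) λ h → Σ (Run any m s′) λ r →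
                     size⁺ h + size⁺ r ≡ size⁺ run)
  high-prefix hs [ move ]⁺ = inj₁ ([ (hs , move) ]⁺ , refl)
  high-prefix hs (_∷_ {y = m} move rest) with W ≤? length m
  ... | no low = inj₂ (m , ≰⇒> low , [ (hs , move) ]⁺ , rest , refl)
  ... | yes hm with high-prefix hm rest
  ...   | inj₁ (h , size≡)                 = inj₁ ((hs , move) ∷ h , cong suc size≡)
  ...   | inj₂ (m′ , m′<W , h , r , size≡) = inj₂ (m′ , m′<W , (hs , move) ∷ h , r , cong suc size≡)

  δ* : Str k → Str k → Str k
  δ* = foldl δ

  nf-++-δ* : ∀ s w → nf (s ++ w) ≡ δ* (nf s) w
  nf-++-δ* s []      = cong nf (++-identityʳ s)
  nf-++-δ* s (a ∷ w) = begin
    nf (s ++ a ∷ w)          ≡⟨ cong nf (++-assoc s [ a ] w) ⟨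
    nf ((s ++ [ a ]) ++ w)   ≡⟨ nf-++-δ* (s ++ [ a ]) w ⟩
    δ* (nf (s ++ [ a ])) w   ≡⟨ cong (λ s′ → δ* s′ w) (nf-++ s [ a ]) ⟩
    δ* (δ (nf s) a) w        ∎
    where open ≡-Reasoning

  word⇒run : ∀ s {w} → ¬ w ≡ [] → Run any s (δ* s w)
  word⇒run s {[]}        w≢[] = ⊥-elim (w≢[] refl)
  word⇒run s {a ∷ []}    _    = [ (a , refl) ]⁺
  word⇒run s {a ∷ b ∷ w} _    = (a , refl) ∷ word⇒run (δ s a) {b ∷ w} (λ ())

  run⇒word : ∀ {s t} → Run any s t → ∃[ w ] ¬ w ≡ [] × δ* s w ≡ t
  run⇒word [ (a , refl) ]⁺     = [ a ] , (λ ()) , refl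
  run⇒word ((a , refl) ∷ rest) with run⇒word rest
  ... | w , _ , δ*≡ = a ∷ w , (λ ()) , δ*≡

module Decision {k : ℕ} (R : SRS k) (terminating : Terminating R) (confluent : Confluent R)
                (forwardClosed : ForwardClosed R) where
  open Rewriting R
  open NormalForms R terminating confluent
  open Runs R terminating confluent forwardClosed

  _≟ₛ_ : (s t : Str k) → Dec (s ≡ t)
  _≟ₛ_ = ≡-dec Fin._≟_

  move? : ∀ κ s t → Dec (Move κ s t)
  move? any  s t = Fin.any? (λ a → δ s a ≟ₛ t)
  move? high s t = (W ≤? length s) ×-dec move? any s t

  Fact : Set
  Fact = Kind × Str k × Str k

  Holds : Fact → Set
  Holds (κ , s , t) = Irreducible R s → Run κ s t

  module Facts (M : ℕ) where

    short : List (Str k)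
    short = words≤ (allFin k) M

    Basic : (Fact → Bool) → Kind → Str k → Str k → Set
    Basic S high s t = Move high s t ⊎
      Any (λ (p , u) → Any (λ (p′ , u′) → p ≡ p′ × T (S (high , u , u′))) (splits t)) (splits s)
    Basic S any  s t = Move any s t ⊎ T (S (high , s , t))

    Derivable : (Fact → Bool) → Fact → Set
    Derivable S (κ , s , t) = Basic S κ s t ⊎ Any (λ m → T (S (κ , s , m)) × T (S (κ , m , t))) short

    basic? : ∀ S κ s t → Dec (Basic S κ s t)
    basic? S high s t = move? high s t ⊎-dec
      Any.any? (λ (p , u) → Any.any? (λ (p′ , u′) → (p ≟ₛ p′) ×-dec T? (S (high , u , u′)))
                                     (splits t))
               (splits s)
    basic? S any  s t = move? any s t ⊎-dec T? (S (high , s , t))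

    derivable? : ∀ S f → Dec (Derivable S f)
    derivable? S (κ , s , t) =
      basic? S κ s t ⊎-dec Any.any? (λ m → T? (S (κ , s , m)) ×-dec T? (S (κ , m , t))) short

    derivable-mono : ∀ {S S′} → S ⊆ᵇ S′ → ∀ {f} → Derivable S f → Derivable S′ f
    derivable-mono S⊆S′ {high , _} (inj₁ (inj₁ move))   = inj₁ (inj₁ move)
    derivable-mono S⊆S′ {high , _} (inj₁ (inj₂ lifted)) =
      inj₁ (inj₂ (Any.map (Any.map (λ (p≡p′ , known) → p≡p′ , S⊆S′ known)) lifted))
    derivable-mono S⊆S′ {any  , _} (inj₁ (inj₁ move))   = inj₁ (inj₁ move)
    derivable-mono S⊆S′ {any  , _} (inj₁ (inj₂ known))  = inj₁ (inj₂ (S⊆S′ known))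
    derivable-mono S⊆S′ (inj₂ via) = inj₂ (Any.map (λ (first , second) → S⊆S′ first , S⊆S′ second) via)

    universe : List Fact
    universe = cartesianProduct (high ∷ any ∷ []) (cartesianProduct short short)

    open Saturation universe Derivable derivable? derivable-mono

    derivable-sound : ∀ {S} → (∀ {f} → T (S f) → Holds f) → ∀ {f} → Derivable S f → Holds f
    derivable-sound sound {high , _}     (inj₁ (inj₁ move)) _ = [ move ]⁺
    derivable-sound sound {high , s , t} (inj₁ (inj₂ lifted)) irr with find lifted
    ... | (p , u) , pu∈ , lifted′ with find lifted′
    ...   | (_ , u′) , pu′∈ , refl , known with splits-sound s pu∈ | splits-sound t pu′∈
    ...     | refl | refl = lift p irr (sound known (irreducible-++⁻ʳ p irr))
    derivable-sound sound {any , _}      (inj₁ (inj₁ move))  _   = [ move ]⁺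
    derivable-sound sound {any , _}      (inj₁ (inj₂ known)) irr = forget (sound known irr)
    derivable-sound sound {κ , _}        (inj₂ via) irr with find via
    ... | _ , _ , first , second =
      let run₁ = sound first irr in run₁ ++⁺ sound second (run-irreducible κ run₁)

    Known : Kind → Str k → Str k → Set
    Known κ s t = T (lfp (κ , s , t))

    known-sound : ∀ {κ s t} → Known κ s t → Irreducible R s → Run κ s t
    known-sound = lfp-sound Holds derivable-sound

    short∈ : ∀ {s} → length s ≤ M → s ∈ short
    short∈ {s} s≤M = ∈-words≤ M s (∈-allFin _) s≤M

    derive : ∀ {κ s t} → length s ≤ M → length t ≤ M → Derivable lfp (κ , s , t) → Known κ s t
    derive {κ} s≤M t≤M =
      lfp-closed (∈-cartesianProduct⁺ (kind∈ κ) (∈-cartesianProduct⁺ (short∈ s≤M) (short∈ t≤M)))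
      where
      kind∈ : ∀ κ → κ ∈ high ∷ any ∷ []
      kind∈ high = here refl
      kind∈ any  = there (here refl)

    known-move : ∀ κ {s t} → length s ≤ M → length t ≤ M → Move κ s t → Known κ s t
    known-move high s≤M t≤M move = derive s≤M t≤M (inj₁ (inj₁ move))
    known-move any  s≤M t≤M move = derive s≤M t≤M (inj₁ (inj₁ move))

    known-trans : ∀ κ {s m t} → length s ≤ M → length m ≤ M → length t ≤ M →
                  Known κ s m → Known κ m t → Known κ s t
    known-trans κ s≤M m≤M t≤M first second = derive s≤M t≤M (inj₂ (lose (short∈ m≤M) (first , second)))

    known-lift : ∀ p {u u′} → length (p ++ u) ≤ M → length (p ++ u′) ≤ M →
                 Known high u u′ → Known high (p ++ u) (p ++ u′)
    known-lift p {u} {u′} s≤M t≤M known =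
      derive s≤M t≤M (inj₁ (inj₂ (lose (∈-splits p u) (lose (∈-splits p u′) (refl , known)))))

    known-forget : ∀ {s t} → length s ≤ M → length t ≤ M → Known high s t → Known any s t
    known-forget s≤M t≤M known = derive s≤M t≤M (inj₁ (inj₂ known))

    module Complete (W+ρ≤M : W + ρ ≤ M) where

      W≤M : W ≤ M
      W≤M = m+n≤o⇒m≤o W W+ρ≤M

      move-bound : ∀ {s t} → length s ≤ W → Irreducible R s → Move any s t → length t ≤ M
      move-bound {s} s≤W irr (a , refl) = ≤-trans (δ-length s a irr) (≤-trans (+-monoˡ-≤ ρ s≤W) W+ρ≤M)

      HighComplete : ℕ → Set
      HighComplete n = ∀ {s t} (run : Run high s t) → size⁺ run ≤ n →
                       Irreducible R s → length s ≤ M → length t ≤ M → Known high s t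

      high-complete-window : ∀ {n} → HighComplete n → ∀ {s t} (run : Run high s t) → size⁺ run ≤ suc n →
                             length s ≤ W → Irreducible R s → length t ≤ M → Known high s t
      high-complete-window _ [ move ]⁺ _ s≤W _ t≤M = known-move high (≤-trans s≤W W≤M) t≤M move
      high-complete-window complete (move ∷ rest) (s≤s size≤) s≤W irr t≤M =
        known-trans high s≤M m≤M t≤M (known-move high s≤M m≤M move)
          (complete rest size≤ (move-irreducible high move) m≤M t≤M)
        where
        s≤M = ≤-trans s≤W W≤M
        m≤M = move-bound s≤W irr (proj₂ move)

      high-complete : ∀ n → HighComplete n
      high-complete zero [ _ ]⁺ ()
      high-complete zero (_ ∷ _) ()
      high-complete (suc n) {s} run size≤ irr s≤M t≤M with split-suffix s (run-high run)
      ... | p , u , refl , |u|≡W with unlift p irr (≤-reflexive (sym |u|≡W)) run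
      ...   | inj₁ (u′ , refl , run′ , size≡) =
        known-lift p s≤M t≤M
          (high-complete-window (high-complete n) run′ (≤-trans (≤-reflexive size≡) size≤)
             (≤-reflexive |u|≡W) (irreducible-++⁻ʳ p irr) (≤-trans (length-++-≤ʳ u′ {p}) t≤M))
      ...   | inj₂ (z , z<W , r₁ , r₂ , size≡) =
        known-trans high s≤M pz≤M t≤M
          (known-lift p s≤M pz≤M
             (high-complete n r₁ (proj₁ sizes≤) (irreducible-++⁻ʳ p irr) (≤-trans (≤-reflexive |u|≡W) W≤M)
                (≤-trans (<⇒≤ z<W) W≤M)))
          (high-complete n r₂ (proj₂ sizes≤) (run-irreducible high (lift p irr r₁)) pz≤M t≤M)
        where
        sizes≤ = both-below (size⁺-positive r₁) (size⁺-positive r₂) (≤-trans (≤-reflexive size≡) size≤)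
        pz≤M : length (p ++ z) ≤ M
        pz≤M = begin
          length (p ++ z)      ≡⟨ length-++ p ⟩
          length p + length z  ≤⟨ +-monoʳ-≤ (length p) (≤-trans (<⇒≤ z<W) (≤-reflexive (sym |u|≡W))) ⟩
          length p + length u  ≡⟨ length-++ p ⟨
          length (p ++ u)      ≤⟨ s≤M ⟩
          M                    ∎
          where open ≤-Reasoning

      any-complete : ∀ n {s t} (run : Run any s t) → size⁺ run ≤ n →
                     Irreducible R s → length s ≤ M → length t ≤ M → Known any s t
      any-complete zero [ _ ]⁺ ()
      any-complete zero (_ ∷ _) ()
      any-complete (suc n) {s} run size≤ irr s≤M t≤M with W ≤? length s
      ... | yes hs with high-prefix hs run
      ...   | inj₁ (h , _) = known-forget s≤M t≤M (high-complete (size⁺ h) h ≤-refl irr s≤M t≤M)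
      ...   | inj₂ (m , m<W , h , rest , size≡) =
        known-trans any s≤M m≤M t≤M
          (known-forget s≤M m≤M (high-complete (size⁺ h) h ≤-refl irr s≤M m≤M))
          (any-complete n rest size≤n (run-irreducible high h) m≤M t≤M)
        where
        m≤M = ≤-trans (<⇒≤ m<W) W≤M
        size≤n = proj₂ (both-below (size⁺-positive h) (size⁺-positive rest) (≤-trans (≤-reflexive size≡) size≤))
      any-complete (suc n) [ move ]⁺ _ _ s≤M t≤M | no _ = known-move any s≤M t≤M move
      any-complete (suc n) (move ∷ rest) (s≤s size≤) irr s≤M t≤M | no low =
        known-trans any s≤M m≤M t≤M (known-move any s≤M m≤M move)
          (any-complete n rest size≤ (move-irreducible any move) m≤M t≤M)
        where
        m≤M = move-bound (<⇒≤ (≰⇒> low)) irr move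

      reachable? : ∀ u v → length (nf u) ≤ M → length v ≤ M →
                   Dec (∃[ w ] (¬ w ≡ [] × NormalForm R (u ++ w) v))
      reachable? u v nfu≤M v≤M with T? (lfp (any , nf u , v))
      ... | yes known with run⇒word (known-sound known (nf-irreducible u))
      ...   | w , w≢[] , δ*≡v =
        yes (w , w≢[] , subst (NormalForm R (u ++ w)) (trans (nf-++-δ* u w) δ*≡v) (nf-normalForm (u ++ w)))
      reachable? u v nfu≤M v≤M | no unknown = no λ (w , w≢[] , u++w→v) →
        let run = subst (Run any (nf u)) (trans (sym (nf-++-δ* u w)) (nf-unique u++w→v)) (word⇒run (nf u) w≢[])
        in unknown (any-complete (size⁺ run) run ≤-refl (nf-irreducible u) nfu≤M v≤M)

  decide : ∀ u v → Dec (∃[ w ] (¬ w ≡ [] × NormalForm R (u ++ w) v))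
  decide u v = Facts.Complete.reachable? M W+ρ≤M u v nfu≤M v≤M
    where
    M = W + ρ + length (nf u) + length v
    W+ρ≤M : W + ρ ≤ M
    W+ρ≤M = ≤-trans (m≤m+n (W + ρ) (length (nf u))) (m≤m+n _ (length v))
    nfu≤M : length (nf u) ≤ M
    nfu≤M = ≤-trans (m≤n+m (length (nf u)) (W + ρ)) (m≤m+n _ (length v))
    v≤M : length v ≤ M
    v≤M = m≤n+m (length v) _

-- The decision procedure does not need u and v to be non-empty.
corollary3 : (k : ℕ) (R : SRS k) → Convergent R → ForwardClosed R →
             (u v : Str k) → ¬ u ≡ [] → ¬ v ≡ [] →
             Dec (∃[ w ] (¬ w ≡ [] × NormalForm R (u ++ w) v))
corollary3 k R (terminating , confluent) forwardClosed u v _ _ =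
  Decision.decide R terminating confluent forwardClosed u v
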